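{- Let $n\in\omega$, let $\Delta$ be a Turing functional (with outputs in $\{0,1\}$), let $E$ be finite and $I$ infinite with every element of $E$ below every element of $I$, and suppose $T=T(n,\Delta,E,I)$ is well-founded. Then a node $\alpha\in T^L$ is terminal in $T^L$ if and only if it is terminal in $T$. Moreover each non-terminal node $\alpha\in T^L$ has infinitely many successors in $T^L$, and either these successors are all labeled with the same numerical value $w$ (and $\alpha$ has label $w$), or they are all labeled $\infty$ (and $\alpha$ has label $\infty$), or each of them has a distinct numerical label (and $\alpha$ has label $\infty$).
   Context: $\lambda$ is the empty string; for nonempty $\alpha$, $\alpha^-=\alpha\upharpoonright(|\alpha|-1)$; $\alpha*x$ is $\alpha$ followed by $x$ (a successor of $\alpha$). $\Delta^X(x)\simeq y$ means $\Delta^X(x)$ diverges or equals $y$; a halting computation with finite oracle $F$ has use bounded by $\max F$. $T(n,\Delta,E,I)\subseteq I^{<\omega}$: $\lambda\in T$, and nonempty $\alpha\in T$ iff $\alpha$ is a strictly increasing string from $I$ and $\Delta^{E\cup F}(w)\simeq0$ for all $F\subseteq\operatorname{ran}(\alpha^-)$ and all $w\geq n$. Labeling of a well-founded $T$ (by recursion from the terminal nodes; labels are numbers or $\infty$): a terminal $\alpha$ is labeled by the least $w\geq n$ such that $\Delta^{E\cup F}(w)\downarrow=1$ for some $F\subseteq\operatorname{ran}(\alpha)$ (such $w$ exists); a non-terminal $\alpha$ is labeled by the least $w$ that labels infinitely many successors of $\alpha$ in $T$ if such $w$ exists, and by $\infty$ otherwise. The labeled subtree $T^L$ (nodes keep their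 labels) is defined from the root down: the root of $T$ is in $T^L$; if $\alpha\in T^L$ has numerical label $w$, every successor of $\alpha$ in $T$ with label $w$ is in $T^L$; if $\alpha\in T^L$ has label $\infty$ and infinitely many of its successors in $T$ have label $\infty$, every successor of $\alpha$ with label $\infty$ is in $T^L$; if $\alpha\in T^L$ has label $\infty$ and only finitely many successors have label $\infty$, then for each number $w$ labeling some successor of $\alpha$, the node $\alpha*x$ with $x$ least such that $\alpha*x$ has label $w$ is put in $T^L$. -}

module Defs where

open import Data.Nat using (ℕ; _≤_; _<_; _≟_)
open import Data.Bool using (Bool; true; false; _∨_)
open import Data.List using (List; []; _∷_; _∷ʳ_; map; upTo)
open import Data.List.Relation.Unary.All using (All)
open import Data.List.Relation.Unary.Linked using (Linked)
open import Data.List.Membership.Propositional using (_∈_)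
open import Data.List.Membership.DecPropositional _≟_ using (_∈?_)
open import Data.List.Relation.Binary.Subset.Propositional using (_⊆_)
open import Data.Product using (Σ; _×_; ∃; ∃-syntax)
open import Relation.Nullary using (¬_; does)
open import Relation.Binary.PropositionalEquality using (_≡_)

Oracle : Set
Oracle = ℕ → Bool

-- Abstract oracle functional with outputs in {0,1} (false = 0, true = 1).
-- Halts X w b  means  Δ^X(w) converges with output b.
record Functional : Set₁ where
  field
    Halts         : Oracle → ℕ → Bool → Set
    deterministic : ∀ {X w b b′} → Halts X w b → Halts X w b′ → b ≡ b′
    extensional   : ∀ {X Y w b} → (∀ x → X x ≡ Y x) → Halts X w b → Halts Y w b

_∪ₒ_ : List ℕ → List ℕ → Oracle
(E ∪ₒ F) x = does (x ∈? E) ∨ does (x ∈? F)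

data Label : Set where
  num : ℕ → Label
  ∞   : Label

-- Strings are lists; α ∷ʳ x is α * x, and (α ∷ʳ x)⁻ = α.
module Tree (n : ℕ) (Δ : Functional) (E : List ℕ) (I : ℕ → Bool) where
  open Functional Δ

  Good : List ℕ → Set
  Good α = ∀ (F : List ℕ) → F ⊆ α → ∀ w → n ≤ w → ¬ Halts (E ∪ₒ F) w true

  data InT : List ℕ → Set where
    root : InT []
    node : ∀ α x → Linked _<_ (α ∷ʳ x) → All (λ y → I y ≡ true) (α ∷ʳ x)
         → Good α → InT (α ∷ʳ x)

  WellFounded : Set
  WellFounded = ¬ (Σ (ℕ → ℕ) λ f → ∀ k → InT (map f (upTo k)))

  TerminalT : List ℕ → Set
  TerminalT α = InT α × (∀ x → ¬ InT (α ∷ʳ x))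

  NonTerminalT : List ℕ → Set
  NonTerminalT α = InT α × ∃[ x ] InT (α ∷ʳ x)

  Least : (ℕ → Set) → ℕ → Set
  Least P w = P w × (∀ v → P v → w ≤ v)

  TermCand : List ℕ → ℕ → Set
  TermCand α w = n ≤ w × ∃[ F ] (F ⊆ α × Halts (E ∪ₒ F) w true)

  module Labeled (L : List ℕ → Label) where

    InfMany : List ℕ → Label → Set
    InfMany α l = ∀ m → ∃[ x ] (m ≤ x × InT (α ∷ʳ x) × L (α ∷ʳ x) ≡ l)

    IsLabeling : Set
    IsLabeling =
      (∀ α → TerminalT α → ∀ w → Least (TermCand α) w → L α ≡ num w)
      × (∀ α → NonTerminalT α →
           (∀ w → Least (λ v → InfMany α (num v)) w → L α ≡ num w)
           × ((¬ (∃[ w ] InfMany α (num w))) → L α ≡ ∞))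

    LeastSucc : List ℕ → ℕ → ℕ → Set
    LeastSucc α w x = InT (α ∷ʳ x) × L (α ∷ʳ x) ≡ num w
                      × (∀ y → InT (α ∷ʳ y) → L (α ∷ʳ y) ≡ num w → x ≤ y)

    data InTL : List ℕ → Set where
      root     : InTL []
      num-step : ∀ α x w → InTL α → L α ≡ num w
               → InT (α ∷ʳ x) → L (α ∷ʳ x) ≡ num w → InTL (α ∷ʳ x)
      inf-step : ∀ α x → InTL α → L α ≡ ∞ → InfMany α ∞
               → InT (α ∷ʳ x) → L (α ∷ʳ x) ≡ ∞ → InTL (α ∷ʳ x)
      fin-step : ∀ α x w → InTL α → L α ≡ ∞ → ¬ InfMany α ∞
               → LeastSucc α w x → InTL (α ∷ʳ x)

    TerminalTL : List ℕ → Set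
    TerminalTL α = ∀ x → ¬ InTL (α ∷ʳ x)

module Submission where

-- The argument is local: everything about a node α ∈ T^L is decided by how
-- its label relates to the labels of its successors in T.
--  * In T, whether α*y is a node depends only on α being good, y ∈ I and
--    y exceeding the last entry of α; as I is infinite, a node of T with one
--    successor has unboundedly many.
--  * By the labeling rule, at a non-terminal node a numerical label w recurs
--    among the successors, while the label ∞ means no number recurs.  If
--    moreover ∞ does not recur, every label occurs only finitely often, so
--    the least successors carrying a given label are unbounded.
--  * Reading the three rules generating T^L backwards shows which case of
--    the classification each node falls into.
-- Hence a node of T^L that is non-terminal in T has unboundedly many
-- successors in T^L, which gives the terminal-node equivalence; the theorem
-- is assembled from these facts at the end.  Excluded middle is used for
-- the least number principle and for the case distinctions of the labeling.
-- Well-foundedness of T and the bound E < I serve only to make the labeling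
-- exist.

open import Defs
open import Axiom.ExcludedMiddle using (ExcludedMiddle)
open import Axiom.DoubleNegationElimination using (em⇒dne)
open import Level using (0ℓ)
open import Data.Nat using (ℕ; _≤_; _<_; suc; _⊔_)
open import Data.Nat.Properties
  using (≤-trans; ≤-antisym; <-trans; ≮⇒≥; m<1+n⇒m<n∨m≡n; m≤m⊔n; m≤n⊔m)
open import Data.Nat.Induction using (<-rec)
open import Data.Bool using (Bool; true)
open import Data.List using (List; []; _∷_; _∷ʳ_; [_])
open import Data.List.Properties using (∷ʳ-injective; ++-conicalʳ)
open import Data.List.Relation.Unary.All using (All)
open import Data.List.Relation.Unary.All.Properties using (∷ʳ⁺; ∷ʳ⁻)
open import Data.List.Relation.Unary.Linked using (Linked; [-]; _∷_)
open import Data.List.Membership.Propositional using (_∈_)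
open import Data.Product using (_×_; ∃-syntax; _,_; proj₁; proj₂)
open import Data.Sum using (_⊎_; inj₁; inj₂)
open import Relation.Nullary using (¬_; yes; no; contradiction)
open import Relation.Binary.Definitions using (Transitive)
open import Relation.Binary.PropositionalEquality using (_≡_; _≢_; refl; sym; trans)

Linked-raise-last : ∀ {A : Set} {R : A → A → Set} → Transitive R →
  ∀ α {x y} → Linked R (α ∷ʳ x) → R x y → Linked R (α ∷ʳ y)
Linked-raise-last _       []          _              _   = [-]
Linked-raise-last R-trans (a ∷ [])    (Rax ∷ [-])    Rxy = R-trans Rax Rxy ∷ [-]
Linked-raise-last R-trans (a ∷ b ∷ α) (Rab ∷ chain)  Rxy =
  Rab ∷ Linked-raise-last R-trans (b ∷ α) chain Rxy

[]≢∷ʳ : ∀ {A : Set} (α : List A) {x : A} → [] ≢ α ∷ʳ x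
[]≢∷ʳ α {x} eq with ++-conicalʳ α [ x ] (sym eq)
... | ()

eventually-avoids-initial-values : ∀ {A : Set} (S : ℕ → Set) (f : ℕ → A) →
  (∀ a → ∃[ M ] (∀ x → M ≤ x → ¬ (S x × f x ≡ a))) →
  ∀ m → ∃[ M ] (∀ x → M ≤ x → S x → ∀ y → y < m → f x ≢ f y)
eventually-avoids-initial-values S f bounded 0 = 0 , λ _ _ _ _ ()
eventually-avoids-initial-values S f bounded (suc m)
  with eventually-avoids-initial-values S f bounded m | bounded (f m)
... | M₁ , avoids-below-m | M₂ , avoids-m = M₁ ⊔ M₂ , avoids
  where
  avoids : ∀ x → M₁ ⊔ M₂ ≤ x → S x → ∀ y → y < suc m → f x ≢ f y
  avoids x M≤x Sx y y<1+m with m<1+n⇒m<n∨m≡n y<1+m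
  ... | inj₁ y<m  = avoids-below-m x (≤-trans (m≤m⊔n M₁ M₂) M≤x) Sx y y<m
  ... | inj₂ refl = λ same → avoids-m x (≤-trans (m≤n⊔m M₁ M₂) M≤x) (Sx , same)

module Classical (em : ExcludedMiddle 0ℓ) where

  least-witness : (P : ℕ → Set) → ∀ k → P k → ∃[ w ] (P w × (∀ v → P v → w ≤ v))
  least-witness P = <-rec (λ k → P k → ∃[ w ] (P w × (∀ v → P v → w ≤ v))) search
    where
    search : ∀ k → (∀ {v} → v < k → P v → ∃[ w ] (P w × (∀ v → P v → w ≤ v)))
           → P k → ∃[ w ] (P w × (∀ v → P v → w ≤ v))
    search k below Pk with em {∃[ v ] (v < k × P v)}
    ... | yes (v , v<k , Pv) = below v<k Pv
    ... | no  none           = k , Pk , λ v Pv → ≮⇒≥ (λ v<k → none (v , v<k , Pv))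

  eventually-fails : (Q : ℕ → Set) → ¬ (∀ m → ∃[ x ] (m ≤ x × Q x)) →
    ∃[ M ] (∀ x → M ≤ x → ¬ Q x)
  eventually-fails Q not-unbounded = em⇒dne em λ no-bound → not-unbounded λ m →
    em⇒dne em λ none-above → no-bound (m , λ x m≤x Qx → none-above (x , m≤x , Qx))

module TreeFacts (n : ℕ) (Δ : Functional) (E : List ℕ) (I : ℕ → Bool) where
  open Tree n Δ E I

  successor-inversion : ∀ α x → InT (α ∷ʳ x) →
    Linked _<_ (α ∷ʳ x) × All (λ y → I y ≡ true) (α ∷ʳ x) × Good α
  successor-inversion α x t = invert t refl
    where
    invert : ∀ {β} → InT β → β ≡ α ∷ʳ x →
      Linked _<_ (α ∷ʳ x) × All (λ y → I y ≡ true) (α ∷ʳ x) × Good α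
    invert root eq = contradiction eq ([]≢∷ʳ α)
    invert (node α′ x′ increasing from-I good) eq with ∷ʳ-injective α′ α eq
    ... | refl , refl = increasing , from-I , good

  successors-unbounded : (∀ m → ∃[ x ] (m ≤ x × I x ≡ true)) →
    ∀ α x₀ → InT (α ∷ʳ x₀) → ∀ m → ∃[ y ] (m ≤ y × InT (α ∷ʳ y))
  successors-unbounded I-unbounded α x₀ t m
    with successor-inversion α x₀ t | I-unbounded (m ⊔ suc x₀)
  ... | increasing , from-I , good | y , bound≤y , Iy =
    y , ≤-trans (m≤m⊔n m (suc x₀)) bound≤y ,
    node α y (Linked-raise-last <-trans α increasing x₀<y)
             (∷ʳ⁺ (proj₁ (∷ʳ⁻ from-I)) Iy) good
    where
    x₀<y : x₀ < y
    x₀<y = ≤-trans (m≤n⊔m m (suc x₀)) bound≤y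

num-injective : ∀ {v w} → num v ≡ num w → v ≡ w
num-injective refl = refl

module LabelFacts (em : ExcludedMiddle 0ℓ)
  (n : ℕ) (Δ : Functional) (E : List ℕ) (I : ℕ → Bool)
  (I-unbounded : ∀ m → ∃[ x ] (m ≤ x × I x ≡ true))
  (L : List ℕ → Label) (labeling : Tree.Labeled.IsLabeling n Δ E I L) where
  open Tree n Δ E I
  open Labeled L
  open TreeFacts n Δ E I
  open Classical em

  labeled-by-recurring-number : ∀ α → NonTerminalT α → ∃[ v ] InfMany α (num v) →
    ∃[ w ] (L α ≡ num w × InfMany α (num w))
  labeled-by-recurring-number α nt (v , v-recurs)
    with least-witness (λ u → InfMany α (num u)) v v-recurs
  ... | w , w-recurs , w-least =
    w , proj₁ (proj₂ labeling α nt) w (w-recurs , w-least) , w-recurs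

  num-label-recurs : ∀ α → NonTerminalT α → ∀ w → L α ≡ num w → InfMany α (num w)
  num-label-recurs α nt w Lα≡w with em {∃[ v ] InfMany α (num v)}
  ... | no none = contradiction (trans (sym Lα≡w) (proj₂ (proj₂ labeling α nt) none)) λ ()
  ... | yes some with labeled-by-recurring-number α nt some
  ...   | v , Lα≡v , v-recurs with num-injective (trans (sym Lα≡w) Lα≡v)
  ...     | refl = v-recurs

  labels-eventually-absent : ∀ α → NonTerminalT α → L α ≡ ∞ → ¬ InfMany α ∞ →
    ∀ l → ∃[ M ] (∀ x → M ≤ x → ¬ (InT (α ∷ʳ x) × L (α ∷ʳ x) ≡ l))
  labels-eventually-absent α nt Lα≡∞ ∞-rare l = eventually-fails _ (rare l)
    where
    rare : ∀ l → ¬ InfMany α l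
    rare ∞       = ∞-rare
    rare (num w) w-recurs with labeled-by-recurring-number α nt (w , w-recurs)
    ... | _ , Lα≡v , _ = contradiction (trans (sym Lα≡∞) Lα≡v) λ ()

  -- In that case the least successors carrying the various labels are unbounded:
  -- beyond the point where all labels of α*0, …, α*(m-1) and ∞ have died out,
  -- take any successor; the least successor sharing its label lies above m.
  least-successors-unbounded : ∀ α → NonTerminalT α → L α ≡ ∞ → ¬ InfMany α ∞ →
    ∀ m → ∃[ x ] (m ≤ x × ∃[ w ] LeastSucc α w x)
  least-successors-unbounded α nt@(_ , x₀ , t₀) Lα≡∞ ∞-rare m
    with eventually-avoids-initial-values (λ x → InT (α ∷ʳ x)) (λ x → L (α ∷ʳ x))
           (labels-eventually-absent α nt Lα≡∞ ∞-rare) m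
       | labels-eventually-absent α nt Lα≡∞ ∞-rare ∞
  ... | M , new-label | M∞ , not-∞
    with successors-unbounded I-unbounded α x₀ t₀ (M ⊔ M∞)
  ... | x , bound≤x , tx with L (α ∷ʳ x) in Lx
  ...   | ∞ = contradiction (tx , Lx) (not-∞ x (≤-trans (m≤n⊔m M M∞) bound≤x))
  ...   | num w with least-witness (λ y → InT (α ∷ʳ y) × L (α ∷ʳ y) ≡ num w) x (tx , Lx)
  ...     | x₁ , (tx₁ , Lx₁) , x₁-least =
    x₁ , m≤x₁ , w , tx₁ , Lx₁ , λ y ty Ly → x₁-least y (ty , Ly)
    where
    m≤x₁ : m ≤ x₁
    m≤x₁ = ≮⇒≥ λ x₁<m →
      new-label x (≤-trans (m≤m⊔n M M∞) bound≤x) tx x₁ x₁<m (trans Lx (sym Lx₁))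

  LeastSucc-relabel : ∀ {α v w x} → LeastSucc α v x → L (α ∷ʳ x) ≡ num w → LeastSucc α w x
  LeastSucc-relabel (tx , Lx≡v , least) Lx≡w with num-injective (trans (sym Lx≡v) Lx≡w)
  ... | refl = tx , Lx≡v , least

  LeastSucc-unique : ∀ {α w x y} → LeastSucc α w x → LeastSucc α w y → x ≡ y
  LeastSucc-unique (tx , Lx , x-least) (ty , Ly , y-least) =
    ≤-antisym (x-least _ ty Ly) (y-least _ tx Lx)

  T^L⊆T : ∀ {α} → InTL α → InT α
  T^L⊆T root                              = root
  T^L⊆T (num-step _ _ _ _ _ t _)          = t
  T^L⊆T (inf-step _ _ _ _ _ t _)          = t
  T^L⊆T (fin-step _ _ _ _ _ _ (t , _ , _)) = t

  data Step (α : List ℕ) (x : ℕ) : Set where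
    num-rule : ∀ w → L α ≡ num w → L (α ∷ʳ x) ≡ num w → Step α x
    inf-rule : L α ≡ ∞ → InfMany α ∞ → L (α ∷ʳ x) ≡ ∞ → Step α x
    fin-rule : ∀ w → L α ≡ ∞ → ¬ InfMany α ∞ → LeastSucc α w x → Step α x

  step-inversion : ∀ {α x} → InTL (α ∷ʳ x) → Step α x
  step-inversion {α} {x} t = invert t refl
    where
    invert : ∀ {β} → InTL β → β ≡ α ∷ʳ x → Step α x
    invert root eq = contradiction eq ([]≢∷ʳ α)
    invert (num-step α′ x′ w _ Lα _ Lx) eq with ∷ʳ-injective α′ α eq
    ... | refl , refl = num-rule w Lα Lx
    invert (inf-step α′ x′ _ Lα recurs _ Lx) eq with ∷ʳ-injective α′ α eq
    ... | refl , refl = inf-rule Lα recurs Lx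
    invert (fin-step α′ x′ w _ Lα rare least) eq with ∷ʳ-injective α′ α eq
    ... | refl , refl = fin-rule w Lα rare least

  data Branching (α : List ℕ) : Set where
    numerical   : ∀ w → L α ≡ num w → Branching α
    ∞-recurring : L α ≡ ∞ → InfMany α ∞ → Branching α
    ∞-rare      : L α ≡ ∞ → ¬ InfMany α ∞ → Branching α

  branching : ∀ α → Branching α
  branching α with L α in Lα
  ... | num w = numerical w Lα
  ... | ∞ with em {InfMany α ∞}
  ...   | yes recurs = ∞-recurring Lα recurs
  ...   | no  rare   = ∞-rare Lα rare

  num-children : ∀ {α w x} → L α ≡ num w → InTL (α ∷ʳ x) → L (α ∷ʳ x) ≡ num w
  num-children Lα t with step-inversion t
  ... | num-rule _ Lα′ Lx with num-injective (trans (sym Lα) Lα′)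
  ...   | refl = Lx
  num-children Lα _ | inf-rule Lα′ _ _   = contradiction (trans (sym Lα) Lα′) λ ()
  num-children Lα _ | fin-rule _ Lα′ _ _ = contradiction (trans (sym Lα) Lα′) λ ()

  ∞-children : ∀ {α x} → L α ≡ ∞ → InfMany α ∞ → InTL (α ∷ʳ x) → L (α ∷ʳ x) ≡ ∞
  ∞-children Lα recurs t with step-inversion t
  ... | num-rule _ Lα′ _    = contradiction (trans (sym Lα) Lα′) λ ()
  ... | inf-rule _ _ Lx     = Lx
  ... | fin-rule _ _ rare _ = contradiction recurs rare

  rare-children : ∀ {α x} → L α ≡ ∞ → ¬ InfMany α ∞ → InTL (α ∷ʳ x) → ∃[ w ] LeastSucc α w x
  rare-children Lα rare t with step-inversion t
  ... | num-rule _ Lα′ _    = contradiction (trans (sym Lα) Lα′) λ ()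
  ... | inf-rule _ recurs _ = contradiction recurs rare
  ... | fin-rule w _ _ least = w , least

  T^L-successors-unbounded : ∀ {α} → InTL α → NonTerminalT α →
    ∀ m → ∃[ x ] (m ≤ x × InTL (α ∷ʳ x))
  T^L-successors-unbounded {α} α∈TL nt m with branching α
  ... | numerical w Lα with num-label-recurs α nt w Lα m
  ...   | x , m≤x , tx , Lx = x , m≤x , num-step α x w α∈TL Lα tx Lx
  T^L-successors-unbounded {α} α∈TL nt m | ∞-recurring Lα recurs with recurs m
  ...   | x , m≤x , tx , Lx = x , m≤x , inf-step α x α∈TL Lα recurs tx Lx
  T^L-successors-unbounded {α} α∈TL nt m | ∞-rare Lα rare
    with least-successors-unbounded α nt Lα rare m
  ...   | x , m≤x , w , least = x , m≤x , fin-step α x w α∈TL Lα rare least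

  TerminalTL⇒TerminalT : ∀ {α} → InTL α → TerminalTL α → TerminalT α
  TerminalTL⇒TerminalT α∈TL terminal = T^L⊆T α∈TL , λ x tx →
    let (y , _ , y∈TL) = T^L-successors-unbounded α∈TL (T^L⊆T α∈TL , x , tx) 0
    in terminal y y∈TL

  TerminalT⇒TerminalTL : ∀ {α} → TerminalT α → TerminalTL α
  TerminalT⇒TerminalTL (_ , no-successor) x x∈TL = no-successor x (T^L⊆T x∈TL)

  ¬TerminalTL⇒NonTerminalT : ∀ {α} → InTL α → ¬ TerminalTL α → NonTerminalT α
  ¬TerminalTL⇒NonTerminalT α∈TL not-terminal =
    T^L⊆T α∈TL , em⇒dne em λ no-successor → not-terminal λ x x∈TL → no-successor (x , T^L⊆T x∈TL)

  ChildShape : List ℕ → Set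
  ChildShape α =
    (∃[ w ] (L α ≡ num w × (∀ x → InTL (α ∷ʳ x) → L (α ∷ʳ x) ≡ num w)))
    ⊎ ((L α ≡ ∞ × (∀ x → InTL (α ∷ʳ x) → L (α ∷ʳ x) ≡ ∞))
    ⊎ (L α ≡ ∞
       × (∀ x → InTL (α ∷ʳ x) → ∃[ w ] (L (α ∷ʳ x) ≡ num w))
       × (∀ x y w → InTL (α ∷ʳ x) → InTL (α ∷ʳ y)
          → L (α ∷ʳ x) ≡ num w → L (α ∷ʳ y) ≡ num w → x ≡ y)))

  child-shape : ∀ α → ChildShape α
  child-shape α with branching α
  ... | numerical w Lα        = inj₁ (w , Lα , λ _ → num-children Lα)
  ... | ∞-recurring Lα recurs = inj₂ (inj₁ (Lα , λ _ → ∞-children Lα recurs))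
  ... | ∞-rare Lα rare        = inj₂ (inj₂ (Lα , numeric , distinct))
    where
    numeric : ∀ x → InTL (α ∷ʳ x) → ∃[ w ] (L (α ∷ʳ x) ≡ num w)
    numeric x x∈TL with rare-children Lα rare x∈TL
    ... | w , _ , Lx , _ = w , Lx
    distinct : ∀ x y w → InTL (α ∷ʳ x) → InTL (α ∷ʳ y)
      → L (α ∷ʳ x) ≡ num w → L (α ∷ʳ y) ≡ num w → x ≡ y
    distinct x y w x∈TL y∈TL Lx Ly with rare-children Lα rare x∈TL | rare-children Lα rare y∈TL
    ... | _ , x-least | _ , y-least =
      LeastSucc-unique (LeastSucc-relabel x-least Lx) (LeastSucc-relabel y-least Ly)

lemma3p5 : ExcludedMiddle 0ℓ →
    ∀ (n : ℕ) (Δ : Functional) (E : List ℕ) (I : ℕ → Bool) →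
    (∀ m → ∃[ x ] (m ≤ x × I x ≡ true)) →
    (∀ e → e ∈ E → ∀ x → I x ≡ true → e < x) →
    let open Tree n Δ E I in
    WellFounded →
    ∀ (L : List ℕ → Label) →
    let open Labeled L in
    IsLabeling →
    ∀ α → InTL α →
      ((TerminalTL α → TerminalT α) × (TerminalT α → TerminalTL α))
      × (¬ TerminalTL α →
          (∀ m → ∃[ x ] (m ≤ x × InTL (α ∷ʳ x)))
          × ((∃[ w ] (L α ≡ num w × (∀ x → InTL (α ∷ʳ x) → L (α ∷ʳ x) ≡ num w)))
             ⊎ ((L α ≡ ∞ × (∀ x → InTL (α ∷ʳ x) → L (α ∷ʳ x) ≡ ∞))
             ⊎ (L α ≡ ∞
                × (∀ x → InTL (α ∷ʳ x) → ∃[ w ] (L (α ∷ʳ x) ≡ num w))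
                × (∀ x y w → InTL (α ∷ʳ x) → InTL (α ∷ʳ y)
                   → L (α ∷ʳ x) ≡ num w → L (α ∷ʳ y) ≡ num w → x ≡ y)))))
lemma3p5 em n Δ E I I-unbounded _ _ L labeling α α∈TL =
  (TerminalTL⇒TerminalT α∈TL , TerminalT⇒TerminalTL)
  , λ not-terminal →
      T^L-successors-unbounded α∈TL (¬TerminalTL⇒NonTerminalT α∈TL not-terminal)
      , child-shape α
  where open LabelFacts em n Δ E I I-unbounded L labeling
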